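{- Every graph with diameter two has a terminal set.
   Context: All graphs are simple and undirected. A set $S \subseteq V(G)$ is in general position if no shortest path of $G$ contains three vertices of $S$. A terminal set of $G$ is a general position set $S$ that is maximal under inclusion and such that for every vertex $u \in V(G)\setminus S$ there is a shortest path of $G$ with $u$ as an endpoint that contains at least two vertices of $S$. -}

module Defs where

open import Data.Nat using (ℕ; _≤_)
open import Data.Fin using (Fin)
open import Data.Fin.Subset using (Subset; _∈_; _∉_; _⊆_)
open import Data.List using (List; []; _∷_; length)
import Data.List.Membership.Propositional as LM
open import Data.Product using (Σ; _×_; ∃; ∃-syntax; _,_)
open import Relation.Binary.PropositionalEquality using (_≡_; _≢_)
open import Relation.Nullary using (¬_; Dec)

record Graph : Set₁ where
  field
    n      : ℕ
    _~_    : Fin n → Fin n → Set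
    ~-sym  : ∀ {u v} → u ~ v → v ~ u
    ~-irr  : ∀ {u} → ¬ (u ~ u)
    ~-dec  : ∀ u v → Dec (u ~ v)

module _ (G : Graph) where
  open Graph G

  V : Set
  V = Fin n

  -- IsWalk u v xs : the vertex list xs is a walk from u to v
  -- (consecutive vertices adjacent); it has (length xs - 1) edges.
  data IsWalk : V → V → List V → Set where
    single : ∀ {u} → IsWalk u u (u ∷ [])
    step   : ∀ {u w v xs} → u ~ w → IsWalk w v xs → IsWalk u v (u ∷ xs)

  -- xs is a shortest u,v-path: a u,v-walk with no strictly shorter u,v-walk.
  -- (Such a walk has no repeated vertices, i.e. it is a geodesic path.)
  IsShortestPath : V → V → List V → Set
  IsShortestPath u v xs =
    IsWalk u v xs × (∀ ys → IsWalk u v ys → length xs ≤ length ys)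

  -- Diameter exactly two: every pair of vertices is joined by a walk with
  -- at most 2 edges (at most 3 vertices), and some pair is not joined by a
  -- walk with at most 1 edge.
  HasDiameterTwo : Set
  HasDiameterTwo =
    (∀ u v → ∃[ xs ] (IsWalk u v xs × length xs ≤ 3))
    × (∃[ u ] ∃[ v ] ¬ (∃[ xs ] (IsWalk u v xs × length xs ≤ 2)))

  GeneralPosition : Subset n → Set
  GeneralPosition S =
    ∀ u v xs → IsShortestPath u v xs →
    ¬ (∃[ x ] ∃[ y ] ∃[ z ]
         (x ≢ y × x ≢ z × y ≢ z
          × x ∈ S × y ∈ S × z ∈ S
          × x LM.∈ xs × y LM.∈ xs × z LM.∈ xs))

  MaximalGeneralPosition : Subset n → Set
  MaximalGeneralPosition S =
    GeneralPosition S × (∀ T → GeneralPosition T → S ⊆ T → T ⊆ S)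

  IsTerminalSet : Subset n → Set
  IsTerminalSet S =
    MaximalGeneralPosition S
    × (∀ u → u ∉ S →
         ∃[ v ] ∃[ xs ]
           (IsShortestPath u v xs
            × ∃[ x ] ∃[ y ] (x ≢ y × x ∈ S × y ∈ S × x LM.∈ xs × y LM.∈ xs)))

{-# OPTIONS --safe #-}
-- In a graph of diameter at most two every shortest path has at most three
-- vertices, so a vertex set is in general position as soon as it induces no
-- path on three vertices, i.e. as soon as it induces a disjoint union of
-- cliques.  Such a set S is built greedily: choose a maximal clique K among
-- the remaining vertices, discard K together with its neighbours, and recurse
-- on what is left.  A discarded vertex u outside S is adjacent to some vertex
-- k of K but, by maximality, not to some k' of K; the induced path u k k' is
-- then a shortest path from u containing two vertices of S.  This gives the
-- terminal property and, since u k k' would violate general position of any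
-- larger set, also maximality.
module Submission where

open import Defs
open import Level using (0ℓ)
open import Function using (_∘_)
open import Data.Empty using (⊥; ⊥-elim)
open import Data.Product using (∃; ∃-syntax; _×_; _,_; proj₁; proj₂)
open import Data.Sum using (inj₁; inj₂)
open import Data.Nat using (ℕ; suc; _≤_; z≤n; s≤s)
open import Data.Nat.Properties using (≤-refl; ≤-trans; ≤-antisym)
open import Data.Fin.Properties using (_≟_)
open import Data.Fin using (Fin)
open import Data.Fin.Subset using (Subset) renaming (_∈_ to _∈ₛ_; _∉_ to _∉ₛ_; _⊆_ to _⊆ₛ_)
open import Data.Fin.Subset.Properties using () renaming (_∈?_ to _∈ₛ?_)
open import Data.Vec using (tabulate)
open import Data.Vec.Properties using (lookup∘tabulate; lookup⇒[]=; []=⇒lookup)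
open import Data.List using (List; []; _∷_; _++_; length; filter; allFin)
open import Data.List.Properties using (length-filter; filter-complete)
open import Data.List.Relation.Unary.All using (All; []; all?)
import Data.List.Relation.Unary.All as All
open import Data.List.Relation.Unary.All.Properties using (¬All⇒Any¬)
open import Data.List.Relation.Unary.Any using (Any; here; there; any?)
open import Data.List.Membership.Propositional using (_∈_; _∉_; find; lose)
open import Data.List.Membership.Propositional.Properties
  using (∈-++⁺ˡ; ∈-++⁺ʳ; ∈-++⁻; ∈-filter⁺; ∈-filter⁻; ∈-allFin)
open import Data.List.Relation.Binary.Permutation.Propositional using (↭-sym)
open import Data.List.Relation.Binary.Permutation.Propositional.Properties
  using (∈-resp-↭; shift)
open import Relation.Binary.PropositionalEquality using (_≡_; _≢_; refl; sym; trans; subst)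
open import Relation.Nullary using (¬_; does; yes; no; ¬?)
open import Relation.Nullary.Decidable using (dec-true)
open import Relation.Unary using (Pred; Decidable; _⊆_; _∪_)

module _ {A : Set} where

  three-distinct⇒3≤length : ∀ {x y z : A} {xs} → x ≢ y → x ≢ z → y ≢ z →
                            x ∈ xs → y ∈ xs → z ∈ xs → 3 ≤ length xs
  three-distinct⇒3≤length {xs = _ ∷ _ ∷ _ ∷ _} _ _ _ _ _ _ = s≤s (s≤s (s≤s z≤n))
  three-distinct⇒3≤length x≢y _ _ (here refl) (here refl) _ = ⊥-elim (x≢y refl)
  three-distinct⇒3≤length x≢y _ _ (there (here refl)) (there (here refl)) _ = ⊥-elim (x≢y refl)
  three-distinct⇒3≤length _ x≢z _ (here refl) _ (here refl) = ⊥-elim (x≢z refl)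
  three-distinct⇒3≤length _ x≢z _ (there (here refl)) _ (there (here refl)) = ⊥-elim (x≢z refl)
  three-distinct⇒3≤length _ _ y≢z _ (here refl) (here refl) = ⊥-elim (y≢z refl)
  three-distinct⇒3≤length _ _ y≢z _ (there (here refl)) (there (here refl)) = ⊥-elim (y≢z refl)

module _ {n : ℕ} where
  open import Data.List.Membership.DecPropositional (_≟_ {n}) using (_∈?_)

  fromList : List (Fin n) → Subset n
  fromList xs = tabulate (λ x → does (x ∈? xs))

  ∈-fromList⁺ : ∀ {x xs} → x ∈ xs → x ∈ₛ fromList xs
  ∈-fromList⁺ {x} {xs} x∈xs =
    lookup⇒[]= x _ (trans (lookup∘tabulate _ x) (dec-true (x ∈? xs) x∈xs))

  ∈-fromList⁻ : ∀ {x xs} → x ∈ₛ fromList xs → x ∈ xs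
  ∈-fromList⁻ {x} {xs} x∈S with x ∈? xs | trans (sym (lookup∘tabulate _ x)) ([]=⇒lookup x∈S)
  ... | yes x∈xs | _ = x∈xs
  ... | no _     | ()

module _ (G : Graph) where
  open Graph G

  IsClique : Pred (V G) 0ℓ → Set
  IsClique P = ∀ {a b} → P a → P b → a ≢ b → a ~ b

  IsCluster : Pred (V G) 0ℓ → Set
  IsCluster P = ∀ {a b c} → P a → P b → P c → a ~ b → b ~ c → a ≢ c → a ~ c

  InducedP₃End : Pred (V G) 0ℓ → V G → Set
  InducedP₃End P u = ∃[ w ] ∃[ v ] (P w × P v × u ~ w × w ~ v × ¬ u ~ v)

  Diameter≤2 : Set
  Diameter≤2 = ∀ u v → ∃[ xs ] (IsWalk G u v xs × length xs ≤ 3)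

  IsClique-∷ : ∀ {x K} → IsClique (_∈ K) → All (x ~_) K → IsClique (_∈ x ∷ K)
  IsClique-∷ _  _   (here refl) (here refl) x≢x = ⊥-elim (x≢x refl)
  IsClique-∷ _  x~K (here refl) (there b∈K) _   = All.lookup x~K b∈K
  IsClique-∷ _  x~K (there a∈K) (here refl) _   = ~-sym (All.lookup x~K a∈K)
  IsClique-∷ cl _   (there a∈K) (there b∈K) a≢b = cl a∈K b∈K a≢b

  IsClique⇒IsCluster : ∀ {P} → IsClique P → IsCluster P
  IsClique⇒IsCluster cl a∈ _ c∈ _ _ a≢c = cl a∈ c∈ a≢c

  IsCluster-anti : ∀ {P Q} → Q ⊆ P → IsCluster P → IsCluster Q
  IsCluster-anti Q⊆P cl a∈ b∈ c∈ = cl (Q⊆P a∈) (Q⊆P b∈) (Q⊆P c∈)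

  IsCluster-∪ : ∀ {P Q} → IsCluster P → IsCluster Q →
                (∀ {p q} → P p → Q q → ¬ p ~ q) → IsCluster (P ∪ Q)
  IsCluster-∪ clP _   _     (inj₁ a∈) (inj₁ b∈) (inj₁ c∈) = clP a∈ b∈ c∈
  IsCluster-∪ _   clQ _     (inj₂ a∈) (inj₂ b∈) (inj₂ c∈) = clQ a∈ b∈ c∈
  IsCluster-∪ _   _   apart (inj₁ a∈) (inj₂ b∈) _         a~b _   = ⊥-elim (apart a∈ b∈ a~b)
  IsCluster-∪ _   _   apart (inj₂ a∈) (inj₁ b∈) _         a~b _   = ⊥-elim (apart b∈ a∈ (~-sym a~b))
  IsCluster-∪ _   _   apart (inj₁ _)  (inj₁ b∈) (inj₂ c∈) _   b~c = ⊥-elim (apart b∈ c∈ b~c)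
  IsCluster-∪ _   _   apart (inj₂ _)  (inj₂ b∈) (inj₁ c∈) _   b~c = ⊥-elim (apart c∈ b∈ (~-sym b~c))

  InducedP₃End-mono : ∀ {P Q u} → P ⊆ Q → InducedP₃End P u → InducedP₃End Q u
  InducedP₃End-mono P⊆Q (w , v , w∈ , v∈ , u~w , w~v , u≁v) =
    w , v , P⊆Q w∈ , P⊆Q v∈ , u~w , w~v , u≁v

  partlyAdjacent⇒InducedP₃End : ∀ {P u k k'} → IsClique P → P k → P k' →
                                u ~ k → ¬ u ~ k' → InducedP₃End P u
  partlyAdjacent⇒InducedP₃End cl k∈ k'∈ u~k u≁k' =
    _ , _ , k∈ , k'∈ , u~k , cl k∈ k'∈ (λ { refl → u≁k' u~k }) , u≁k'

  record MaximalCliqueExtension (K xs : List (V G)) : Set where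
    field
      clique   : List (V G)
      extends  : (_∈ K) ⊆ (_∈ clique)
      within   : (_∈ clique) ⊆ (_∈ K ++ xs)
      isClique : IsClique (_∈ clique)
      maximal  : ∀ {y} → y ∈ xs → y ∉ clique → ∃[ k ] (k ∈ clique × ¬ y ~ k)

  extendClique : ∀ {K} → IsClique (_∈ K) → ∀ xs → MaximalCliqueExtension K xs
  extendClique {K} cl [] = record
    { clique = K ; extends = λ k∈ → k∈ ; within = ∈-++⁺ˡ ; isClique = cl ; maximal = λ () }
  extendClique {K} cl (x ∷ xs) with all? (~-dec x) K
  ... | yes x~K = record
    { E ; extends = E.extends ∘ there
    ; within = ∈-resp-↭ (↭-sym (shift x K xs)) ∘ E.within
    ; maximal = λ { (here refl) x∉ → ⊥-elim (x∉ (E.extends (here refl)))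
                  ; (there y∈) → E.maximal y∈ } }
    where module E = MaximalCliqueExtension (extendClique (IsClique-∷ cl x~K) xs)
  ... | no x≁K = record
    { E ; within = ∈-resp-↭ (↭-sym (shift x K xs)) ∘ there ∘ E.within
    ; maximal = λ { (here refl) _ → nonNeighbour ; (there y∈) → E.maximal y∈ } }
    where
    module E = MaximalCliqueExtension (extendClique cl xs)
    nonNeighbour : ∃[ k ] (k ∈ E.clique × ¬ x ~ k)
    nonNeighbour with find (¬All⇒Any¬ (~-dec x) K x≁K)
    ... | k , k∈K , x≁k = k , E.extends k∈K , x≁k

  record CoveringCluster (R : List (V G)) : Set where
    field
      cluster     : List (V G)
      cluster⊆R   : (_∈ cluster) ⊆ (_∈ R)
      isCluster   : IsCluster (_∈ cluster)
      outsideEnds : ∀ {u} → u ∈ R → u ∉ cluster → InducedP₃End (_∈ cluster) u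

  NoNeighbourIn : List (V G) → Pred (V G) 0ℓ
  NoNeighbourIn K u = ¬ Any (u ~_) K

  noNeighbourIn? : ∀ K → Decidable (NoNeighbourIn K)
  noNeighbourIn? K u = ¬? (any? (~-dec u) K)

  peelClique : ∀ {r rest} (E : MaximalCliqueExtension (r ∷ []) rest) →
               let open MaximalCliqueExtension E in
               CoveringCluster (filter (noNeighbourIn? clique) rest) →
               CoveringCluster (r ∷ rest)
  peelClique {r} {rest} E C = record
    { cluster     = K ++ T
    ; cluster⊆R   = cluster⊆R
    ; isCluster   = IsCluster-anti (∈-++⁻ K)
                      (IsCluster-∪ (IsClique⇒IsCluster E.isClique) C.isCluster apart)
    ; outsideEnds = outsideEnds
    }
    where
    module E = MaximalCliqueExtension E
    module C = CoveringCluster C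
    K = E.clique
    T = C.cluster

    T⊆remaining : ∀ {t} → t ∈ T → t ∈ rest × NoNeighbourIn K t
    T⊆remaining = ∈-filter⁻ (noNeighbourIn? K) ∘ C.cluster⊆R

    apart : ∀ {k t} → k ∈ K → t ∈ T → ¬ k ~ t
    apart k∈K t∈T k~t = proj₂ (T⊆remaining t∈T) (lose k∈K (~-sym k~t))

    cluster⊆R : (_∈ K ++ T) ⊆ (_∈ r ∷ rest)
    cluster⊆R x∈ with ∈-++⁻ K x∈
    ... | inj₁ x∈K = E.within x∈K
    ... | inj₂ x∈T = there (proj₁ (T⊆remaining x∈T))

    outsideEnds : ∀ {u} → u ∈ r ∷ rest → u ∉ K ++ T → InducedP₃End (_∈ K ++ T) u
    outsideEnds (here refl) u∉ = ⊥-elim (u∉ (∈-++⁺ˡ (E.extends (here refl))))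
    outsideEnds {u} (there u∈rest) u∉ with any? (~-dec u) K
    ... | yes u~K with find u~K | E.maximal u∈rest (u∉ ∘ ∈-++⁺ˡ)
    ...   | k , k∈K , u~k | k' , k'∈K , u≁k' =
      InducedP₃End-mono ∈-++⁺ˡ (partlyAdjacent⇒InducedP₃End E.isClique k∈K k'∈K u~k u≁k')
    outsideEnds {u} (there u∈rest) u∉ | no u≁K =
      InducedP₃End-mono (∈-++⁺ʳ K) (C.outsideEnds (∈-filter⁺ _ u∈rest u≁K) (u∉ ∘ ∈-++⁺ʳ K))

  coveringCluster : ∀ R → CoveringCluster R
  coveringCluster R = build (length R) R ≤-refl
    where
    build : ∀ fuel R → length R ≤ fuel → CoveringCluster R
    build _ [] _ = record
      { cluster = [] ; cluster⊆R = λ () ; isCluster = λ () ; outsideEnds = λ () }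
    build (suc fuel) (r ∷ rest) (s≤s |rest|≤fuel) =
      peelClique E (build fuel _ (≤-trans (length-filter _ rest) |rest|≤fuel))
      where E = extendClique (IsClique-∷ (λ ()) []) rest

  shortestPath-length≤3 : ∀ {u v xs} → Diameter≤2 → IsShortestPath G u v xs → length xs ≤ 3
  shortestPath-length≤3 {u} {v} diam (_ , shortest) with diam u v
  ... | ys , walk , |ys|≤3 = ≤-trans (shortest ys walk) |ys|≤3

  inducedP₃-isShortestPath : ∀ {u w v} → u ≢ v → u ~ w → w ~ v → ¬ u ~ v →
                             IsShortestPath G u v (u ∷ w ∷ v ∷ [])
  inducedP₃-isShortestPath {u} {w} {v} u≢v u~w w~v u≁v = step u~w (step w~v single) , shortest
    where
    shortest : ∀ ys → IsWalk G u v ys → 3 ≤ length ys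
    shortest _ single                      = ⊥-elim (u≢v refl)
    shortest _ (step u~v single)           = ⊥-elim (u≁v u~v)
    shortest _ (step _ (step _ single))    = s≤s (s≤s (s≤s z≤n))
    shortest _ (step _ (step _ (step _ _))) = s≤s (s≤s (s≤s z≤n))

  cluster-noShortestPath₃ : ∀ {P u v xs} → IsCluster P → IsShortestPath G u v xs →
                            length xs ≡ 3 → (∀ {a} → a ∈ xs → P a) → ⊥
  cluster-noShortestPath₃ cl (step {u = a} {v = c} a~b (step b~c single) , shortest) _ inP =
    a≁c (cl (inP (here refl)) (inP (there (here refl))) (inP (there (there (here refl))))
            a~b b~c a≢c)
    where
    a≁c : ¬ a ~ c
    a≁c a~c with shortest _ (step a~c single)
    ... | s≤s (s≤s ())
    a≢c : a ≢ c
    a≢c refl with shortest _ single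
    ... | s≤s ()
  cluster-noShortestPath₃ _ (step _ (step _ (step _ single)) , _) () _
  cluster-noShortestPath₃ _ (step _ (step _ (step _ (step _ _))) , _) () _

  cluster⇒generalPosition : ∀ {S} → Diameter≤2 → IsCluster (_∈ₛ S) → GeneralPosition G S
  cluster⇒generalPosition {S} diam cl u v xs sp
    (x , y , z , x≢y , x≢z , y≢z , xS , yS , zS , x∈ , y∈ , z∈) =
    cluster-noShortestPath₃ cl sp |xs|≡3 xs⊆S
    where
    inS = filter (_∈ₛ? S) xs
    |xs|≤3 : length xs ≤ 3
    |xs|≤3 = shortestPath-length≤3 diam sp
    3≤|inS| : 3 ≤ length inS
    3≤|inS| = three-distinct⇒3≤length x≢y x≢z y≢z
                (∈-filter⁺ (_∈ₛ? S) x∈ xS) (∈-filter⁺ (_∈ₛ? S) y∈ yS)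
                (∈-filter⁺ (_∈ₛ? S) z∈ zS)
    |xs|≡3 : length xs ≡ 3
    |xs|≡3 = ≤-antisym |xs|≤3 (≤-trans 3≤|inS| (length-filter (_∈ₛ? S) xs))
    inS≡xs : inS ≡ xs
    inS≡xs = filter-complete (_∈ₛ? S) {xs}
               (≤-antisym (length-filter (_∈ₛ? S) xs) (≤-trans |xs|≤3 3≤|inS|))
    xs⊆S : ∀ {a} → a ∈ xs → a ∈ₛ S
    xs⊆S a∈ = proj₂ (∈-filter⁻ (_∈ₛ? S) {xs = xs} (subst (_ ∈_) (sym inS≡xs) a∈))

  inducedP₃Ends⇒terminal : ∀ {S} → GeneralPosition G S →
                           (∀ u → u ∉ₛ S → InducedP₃End (_∈ₛ S) u) → IsTerminalSet G S
  inducedP₃Ends⇒terminal {S} gp ends = (gp , maximal) , terminal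
    where
    terminal : ∀ u → u ∉ₛ S → ∃[ v ] ∃[ xs ] (IsShortestPath G u v xs ×
                 ∃[ x ] ∃[ y ] (x ≢ y × x ∈ₛ S × y ∈ₛ S × x ∈ xs × y ∈ xs))
    terminal u u∉S with ends u u∉S
    ... | w , v , w∈S , v∈S , u~w , w~v , u≁v =
      v , _ , inducedP₃-isShortestPath (λ { refl → u∉S v∈S }) u~w w~v u≁v ,
      w , v , (λ { refl → u≁v u~w }) , w∈S , v∈S , there (here refl) , there (there (here refl))

    maximal : ∀ T → GeneralPosition G T → S ⊆ₛ T → T ⊆ₛ S
    maximal T gpT S⊆T {x} x∈T with x ∈ₛ? S
    ... | yes x∈S = x∈S
    ... | no x∉S with ends x x∉S
    ...   | w , v , w∈S , v∈S , x~w , w~v , x≁v =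
      ⊥-elim (gpT x v _ (inducedP₃-isShortestPath (λ { refl → x∉S v∈S }) x~w w~v x≁v)
        (x , w , v , (λ { refl → x∉S w∈S }) , (λ { refl → x∉S v∈S }) , (λ { refl → x≁v x~w })
         , x∈T , S⊆T w∈S , S⊆T v∈S , here refl , there (here refl) , there (there (here refl))))

theorem3p1 : (G : Graph) → HasDiameterTwo G → ∃ (λ (S : Subset (Graph.n G)) → IsTerminalSet G S)
theorem3p1 G (diam≤2 , _) = S , inducedP₃Ends⇒terminal G gp ends
  where
  open CoveringCluster (coveringCluster G (allFin (Graph.n G)))
  S = fromList cluster

  gp : GeneralPosition G S
  gp = cluster⇒generalPosition G diam≤2 (IsCluster-anti G ∈-fromList⁻ isCluster)

  ends : ∀ u → u ∉ₛ S → InducedP₃End G (_∈ₛ S) u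
  ends u u∉S = InducedP₃End-mono G ∈-fromList⁺ (outsideEnds (∈-allFin u) (u∉S ∘ ∈-fromList⁺))
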